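{- Let $\mathcal{A}$ be a recursive algorithm enumerating a finite set $S$ and assume that $\mathcal{A}$ satisfies the Pyramid condition with respect to a potential $\Phi$, time $T^\star$ and constant $\mu>0$. Let $\Delta$ be an upper bound on the total number of instructions executed by all iterations on any path in the recursion tree from the root to a leaf. Then for all $1\le i\le j\le |S|$, the number of instructions executed between visiting the $i$-th and the $j$-th element of $S$ (in the order in which $\mathcal{A}$ visits them) is at most $2\Delta + (j-i)\mu T^\star - 1$. Furthermore, the number of instructions executed before visiting the $j$-th element is at most $\Delta + j\mu T^\star - 1$.
   Context: Setting (recursive enumeration algorithms): A recursive algorithm $\mathcal{A}$ enumerates ("visits") every element of a finite set $S$ exactly once. Its recursive calls form a recursion tree; an iteration is one execution of the recursive function, excluding the computation done inside the calls it makes recursively, and iterations are identified with nodes of the recursion tree. Each iteration is labeled by the set $X\subseteq S$ of elements visited by that iteration or any of its descendants. In iteration $X$ a partition $X = X_1 \,\dot\cup\, \cdots \,\dot\cup\, X_m \,\dot\cup\, X'$ with $X_1,\dots,X_m\neq\emptyset$ is formed, where $X'$ (possibly empty) is the set of elements visited directly by $X$, and the function is called recursively on $X_1,\dots,X_m$ (the children of $X$, forming $C(X)$). A leaf iteration is one without children. $T(X)$ denotes the number of instructions executed by iteration $X$ itself. A potential function $\Phi$ assigns a number $\Phi(X)>0$ to every iteration. Pyramid condition: $\mathcal{A}$ satisfies it with respect to $\Phi$, time $T^\star>0$ and constant $\mu>0$ if for every iteration $X$, $\sum_{Y\in C(X)} \Phi(Y) + \mu |X'| - \Phi(X) \ge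 T(X)/T^\star$.
   Formalization: The potential Φ, the time $T^\star$, the constant μ and the bound Δ take only rational values. -}

module Defs where

open import Data.Nat as ℕ using (ℕ; zero; suc; _∸_)
open import Data.Integer using (+_)
open import Data.Rational as ℚ using (ℚ; _/_; _÷_; _+_; _*_; _-_; _≤_; _<_; 0ℚ; positive)
open import Data.Rational.Properties using (pos⇒nonZero)
open import Data.Fin using (Fin)
open import Data.Bool using (Bool; true; false)
open import Data.List using (List; []; _∷_; _++_; map; sum; concatMap; length)
open import Data.List.Membership.Propositional using (_∈_)
open import Data.List.Relation.Unary.Any using (Any)
open import Data.Product using (_×_; ∃)
open import Data.List.Relation.Unary.Unique.Propositional using (Unique)
open import Relation.Nullary using (¬_)
open import Relation.Binary.PropositionalEquality using (_≡_)

ι : ℕ → ℚ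
ι k = (+ k) / 1

-- Recursion trees of a recursive enumeration algorithm for S = Fin n.
-- An iteration (node) carries its potential Φ(X) and the sequence of
-- what it does, in execution order:
--   ins      : one ordinary instruction of this iteration,
--   vis x    : one instruction of this iteration that visits element x,
--   call t   : a recursive call, whose whole execution is the subtree t.

mutual
  data Step (n : ℕ) : Set where
    ins  : Step n
    vis  : Fin n → Step n
    call : Iteration n → Step n

  data Iteration (n : ℕ) : Set where
    node : (Φ : ℚ) → (code : List (Step n)) → Iteration n

module _ {n : ℕ} where

  potential : Iteration n → ℚ
  potential (node Φ _) = Φ

  code : Iteration n → List (Step n)
  code (node _ c) = c

  ownT : List (Step n) → ℕ
  ownT []            = 0
  ownT (ins ∷ s)     = suc (ownT s)
  ownT (vis _ ∷ s)   = suc (ownT s)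
  ownT (call _ ∷ s)  = ownT s

  T : Iteration n → ℕ
  T t = ownT (code t)

  ownVisits : List (Step n) → List (Fin n)
  ownVisits []           = []
  ownVisits (ins ∷ s)    = ownVisits s
  ownVisits (vis x ∷ s)  = x ∷ ownVisits s
  ownVisits (call _ ∷ s) = ownVisits s

  X′ : Iteration n → List (Fin n)
  X′ t = ownVisits (code t)

  childrenS : List (Step n) → List (Iteration n)
  childrenS []           = []
  childrenS (ins ∷ s)    = childrenS s
  childrenS (vis _ ∷ s)  = childrenS s
  childrenS (call t ∷ s) = t ∷ childrenS s

  C : Iteration n → List (Iteration n)
  C t = childrenS (code t)

  mutual
    visits : Iteration n → List (Fin n)
    visits (node _ c) = visitsS c

    visitsS : List (Step n) → List (Fin n)
    visitsS []           = []
    visitsS (ins ∷ s)    = visitsS s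
    visitsS (vis x ∷ s)  = x ∷ visitsS s
    visitsS (call t ∷ s) = visits t ++ visitsS s

  mutual
    -- The full execution trace: one entry per executed instruction, in
    -- execution order; 'true' marks an instruction visiting an element.
    trace : Iteration n → List Bool
    trace (node _ c) = traceS c

    traceS : List (Step n) → List Bool
    traceS []           = []
    traceS (ins ∷ s)    = false ∷ traceS s
    traceS (vis _ ∷ s)  = true ∷ traceS s
    traceS (call t ∷ s) = trace t ++ traceS s

  mutual
    nodes : Iteration n → List (Iteration n)
    nodes t@(node _ c) = t ∷ nodesS c

    nodesS : List (Step n) → List (Iteration n)
    nodesS []           = []
    nodesS (ins ∷ s)    = nodesS s
    nodesS (vis _ ∷ s)  = nodesS s
    nodesS (call t ∷ s) = nodes t ++ nodesS s

  mutual
    pathCosts : Iteration n → List ℕ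
    pathCosts t@(node _ c) with childrenS c
    ... | []    = T t ∷ []
    ... | _ ∷ _ = map (T t ℕ.+_) (pathCostsS c)

    pathCostsS : List (Step n) → List ℕ
    pathCostsS []           = []
    pathCostsS (ins ∷ s)    = pathCostsS s
    pathCostsS (vis _ ∷ s)  = pathCostsS s
    pathCostsS (call t ∷ s) = pathCosts t ++ pathCostsS s

-- Number of executed instructions strictly before the k-th (1-based)
-- visiting instruction of a trace.
before : ℕ → List Bool → ℕ
before zero          _            = 0
before (suc k)       []           = 0
before (suc k)       (false ∷ bs) = suc (before (suc k) bs)
before (suc zero)    (true ∷ bs)  = 0
before (suc (suc k)) (true ∷ bs)  = suc (before (suc k) bs)

-- Number of executed instructions strictly between the i-th and the j-th
-- visiting instruction (i ≤ j); 0 when i = j.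
between : ℕ → ℕ → List Bool → ℕ
between i j bs = before j bs ∸ before i bs ∸ 1

sumℚ : List ℚ → ℚ
sumℚ []       = 0ℚ
sumℚ (q ∷ qs) = q + sumℚ qs

PyramidAt : ∀ {n} (T⋆ : ℚ) → 0ℚ < T⋆ → (μ : ℚ) → Iteration n → Set
PyramidAt T⋆ 0<T⋆ μ X =
  (ι (T X) ÷ T⋆) {{pos⇒nonZero T⋆ {{positive 0<T⋆}}}}
    ≤ sumℚ (map potential (C X)) + μ * ι (length (X′ X)) - potential X

Enumerates : ∀ {n} → Iteration n → Set
Enumerates {n} t =
  Unique (visits t) × (∀ (x : Fin n) → x ∈ visits t)
  × (∀ Y → Y ∈ nodes t → ∀ Z → Z ∈ C Y → ¬ (visits Z ≡ []))

-- Let K = μ T⋆ and call the number of instructions in a stretch of the trace minus K per visit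
-- in it the excess of the stretch.  Summing the Pyramid condition bottom-up shows that the
-- complete execution of an iteration X has excess at most −T⋆ Φ(X) < 0.  A stretch that ends
-- just before a visit, starts just after one, or lies between two visits consists of complete
-- executions of children, whose excess is nonpositive, and of instructions of the iterations on
-- the root-to-leaf paths through its bounding visits; these instructions, together with the
-- bounding visits themselves, cost at most Δ per path.  Hence the prefix before the j-th visit
-- has excess at most Δ − 1 and the stretch between the i-th and the j-th visit has excess at
-- most 2Δ − 2; adding back K per visit inside the stretch gives the two bounds.

{-# OPTIONS --safe #-}
module Submission where

open import Defs
open import Data.Nat using (ℕ; _∸_)
open import Data.Product using (_×_)
open import Data.List.Membership.Propositional using (_∈_)
open import Data.Rational using (ℚ; 0ℚ; 1ℚ; _+_; _*_; _-_; _≤_; _<_)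

open import Algebra.Bundles using (CommutativeMonoid)
open import Data.Bool using (Bool; true; false)
open import Data.Fin using (Fin)
open import Data.Fin.Properties using (injective⇒≤)
open import Data.Integer as ℤ using (+_)
import Data.Integer.Properties as ℤ
open import Data.List using (List; []; _∷_; _++_; length; lookup; map)
open import Data.List.Membership.Propositional.Properties using (∈-++⁺ˡ; ∈-++⁺ʳ; ∈-map⁺)
open import Data.List.Properties using (length-++)
open import Data.List.Relation.Unary.All as All using (All; []; _∷_)
open import Data.List.Relation.Unary.All.Properties using (++⁺; ++⁻ˡ; ++⁻ʳ)
open import Data.List.Relation.Unary.Any using (here)
open import Data.List.Relation.Unary.Any.Properties using (lookup-index)
open import Data.Nat as ℕ using (zero; suc; z≤n; s≤s; _⊔_)
import Data.Nat.Properties as ℕ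
open import Data.Nat.Coprimality using (1-coprimeTo) renaming (sym to coprime-sym)
open import Data.Product using (_,_)
open import Data.Rational as ℚ using (mkℚ; -_; _÷_)
open import Data.Rational.Properties
open import Data.Rational.Solver using (module +-*-Solver)
import Data.Rational.Unnormalised.Base as ℚᵘ
import Data.Rational.Unnormalised.Properties as ℚᵘ
open import Data.Sum using (inj₁; inj₂)
open import Relation.Binary.PropositionalEquality

open import Algebra.Properties.CommutativeSemigroup
  (CommutativeMonoid.commutativeSemigroup +-0-commutativeMonoid)
  using (x∙yz≈y∙xz; xy∙z≈xz∙y; interchange)

ι≡mkℚ : ∀ k → ι k ≡ mkℚ (+ k) 0 (coprime-sym (1-coprimeTo k))
ι≡mkℚ k = normalize-coprime _

ι-+ : ∀ m n → ι (m ℕ.+ n) ≡ ι m + ι n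
ι-+ m n rewrite ι≡mkℚ (m ℕ.+ n) | ι≡mkℚ m | ι≡mkℚ n =
  toℚᵘ-injective (ℚᵘ.≃-trans (ℚᵘ.*≡* numerators) (ℚᵘ.≃-sym (toℚᵘ-homo-+ ιm ιn)))
  where
  open ≡-Reasoning
  ιm = mkℚ (+ m) 0 (coprime-sym (1-coprimeTo m))
  ιn = mkℚ (+ n) 0 (coprime-sym (1-coprimeTo n))
  numerators : + (m ℕ.+ n) ℤ.* + 1 ≡ (+ m ℤ.* + 1 ℤ.+ + n ℤ.* + 1) ℤ.* + 1
  numerators = begin
    + (m ℕ.+ n) ℤ.* + 1                   ≡⟨ ℤ.*-identityʳ _ ⟩
    + (m ℕ.+ n)                           ≡⟨ ℤ.pos-+ m n ⟩
    + m ℤ.+ + n                           ≡⟨ cong₂ ℤ._+_ (ℤ.*-identityʳ (+ m)) (ℤ.*-identityʳ (+ n)) ⟨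
    + m ℤ.* + 1 ℤ.+ + n ℤ.* + 1           ≡⟨ ℤ.*-identityʳ _ ⟨
    (+ m ℤ.* + 1 ℤ.+ + n ℤ.* + 1) ℤ.* + 1 ∎

ι-suc : ∀ k → ι (suc k) ≡ 1ℚ + ι k
ι-suc = ι-+ 1

0≤ι : ∀ k → 0ℚ ≤ ι k
0≤ι k rewrite ι≡mkℚ k = nonNegative⁻¹ _

p≤p+q : ∀ p {q} → 0ℚ ≤ q → p ≤ p + q
p≤p+q p {q} 0≤q = begin
  p      ≡⟨ +-identityʳ p ⟨
  p + 0ℚ ≤⟨ +-monoʳ-≤ p 0≤q ⟩
  p + q  ∎
  where open ≤-Reasoning

ι-mono-≤ : ∀ {m n} → m ℕ.≤ n → ι m ≤ ι n
ι-mono-≤ {m} m≤n with o , refl ← ℕ.m≤n⇒∃[o]m+o≡n m≤n =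
  ≤-trans (p≤p+q (ι m) (0≤ι o)) (≤-reflexive (sym (ι-+ m o)))

p-q≤p : ∀ p {q} → 0ℚ ≤ q → p - q ≤ p
p-q≤p p 0≤q = ≤-trans (+-monoʳ-≤ p (neg-antimono-≤ 0≤q)) (≤-reflexive (+-identityʳ p))

p≤0∧q≤r⇒p+q≤r : ∀ {p q r} → p ≤ 0ℚ → q ≤ r → p + q ≤ r
p≤0∧q≤r⇒p+q≤r {r = r} p≤0 q≤r = ≤-trans (+-mono-≤ p≤0 q≤r) (≤-reflexive (+-identityˡ r))

+-cancelʳ-≤ : ∀ r {p q} → p + r ≤ q + r → p ≤ q
+-cancelʳ-≤ r {p} {q} p+r≤q+r = begin
  p          ≡⟨ +-r-r p ⟨
  p + r - r  ≤⟨ +-monoˡ-≤ (- r) p+r≤q+r ⟩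
  q + r - r  ≡⟨ +-r-r q ⟩
  q          ∎
  where
  open ≤-Reasoning
  +-r-r : ∀ x → x + r - r ≡ x
  +-r-r x = trans (+-assoc x r (- r)) (trans (cong (_+_ x) (+-inverseʳ r)) (+-identityʳ x))

1+p≤q⇒p≤q-1 : ∀ {p q} → 1ℚ + p ≤ q → p ≤ q - 1ℚ
1+p≤q⇒p≤q-1 {p} {q} 1+p≤q = +-cancelʳ-≤ 1ℚ (begin
  p + 1ℚ           ≡⟨ +-comm p 1ℚ ⟩
  1ℚ + p           ≤⟨ 1+p≤q ⟩
  q                ≡⟨ +-identityʳ q ⟨
  q + 0ℚ           ≡⟨ cong (_+_ q) (+-inverseˡ 1ℚ) ⟨
  q + (- 1ℚ + 1ℚ)  ≡⟨ +-assoc q (- 1ℚ) 1ℚ ⟨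
  q - 1ℚ + 1ℚ      ∎)
  where open ≤-Reasoning

2*p≡p+p : ∀ p → ι 2 * p ≡ p + p
2*p≡p+p p = trans (*-distribʳ-+ p 1ℚ 1ℚ) (cong₂ _+_ (*-identityˡ p) (*-identityˡ p))

#visits : List Bool → ℕ
#visits []           = 0
#visits (true ∷ bs)  = suc (#visits bs)
#visits (false ∷ bs) = #visits bs

-- Visits are numbered from 0 here, but from 1 by 'before' and 'between'.
beforeVisit : ℕ → List Bool → List Bool
beforeVisit k       []           = []
beforeVisit k       (false ∷ bs) = false ∷ beforeVisit k bs
beforeVisit zero    (true ∷ bs)  = []
beforeVisit (suc k) (true ∷ bs)  = true ∷ beforeVisit k bs

afterVisit : ℕ → List Bool → List Bool
afterVisit k       []           = []
afterVisit k       (false ∷ bs) = afterVisit k bs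
afterVisit zero    (true ∷ bs)  = bs
afterVisit (suc k) (true ∷ bs)  = afterVisit k bs

#visits-++ : ∀ as bs → #visits (as ++ bs) ≡ #visits as ℕ.+ #visits bs
#visits-++ []           bs = refl
#visits-++ (true ∷ as)  bs = cong suc (#visits-++ as bs)
#visits-++ (false ∷ as) bs = #visits-++ as bs

#visits-beforeVisit : ∀ k bs → #visits (beforeVisit k bs) ℕ.≤ k
#visits-beforeVisit k       []           = z≤n
#visits-beforeVisit k       (false ∷ bs) = #visits-beforeVisit k bs
#visits-beforeVisit zero    (true ∷ bs)  = z≤n
#visits-beforeVisit (suc k) (true ∷ bs)  = s≤s (#visits-beforeVisit k bs)

#visits-afterVisit : ∀ {k} bs → k ℕ.< #visits bs →
                     #visits bs ≡ suc k ℕ.+ #visits (afterVisit k bs)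
#visits-afterVisit         (false ∷ bs) k<       = #visits-afterVisit bs k<
#visits-afterVisit {zero}  (true ∷ bs)  _        = refl
#visits-afterVisit {suc k} (true ∷ bs)  (s≤s k<) = cong suc (#visits-afterVisit bs k<)

beforeVisit-++ˡ : ∀ {k} as bs → k ℕ.< #visits as → beforeVisit k (as ++ bs) ≡ beforeVisit k as
beforeVisit-++ˡ         (false ∷ as) bs k<       = cong (false ∷_) (beforeVisit-++ˡ as bs k<)
beforeVisit-++ˡ {zero}  (true ∷ as)  bs _        = refl
beforeVisit-++ˡ {suc k} (true ∷ as)  bs (s≤s k<) = cong (true ∷_) (beforeVisit-++ˡ as bs k<)

beforeVisit-++ʳ : ∀ {k} as bs →
                  beforeVisit (#visits as ℕ.+ k) (as ++ bs) ≡ as ++ beforeVisit k bs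
beforeVisit-++ʳ []           bs = refl
beforeVisit-++ʳ (false ∷ as) bs = cong (false ∷_) (beforeVisit-++ʳ as bs)
beforeVisit-++ʳ (true ∷ as)  bs = cong (true ∷_) (beforeVisit-++ʳ as bs)

afterVisit-++ˡ : ∀ {k} as bs → k ℕ.< #visits as → afterVisit k (as ++ bs) ≡ afterVisit k as ++ bs
afterVisit-++ˡ         (false ∷ as) bs k<       = afterVisit-++ˡ as bs k<
afterVisit-++ˡ {zero}  (true ∷ as)  bs _        = refl
afterVisit-++ˡ {suc k} (true ∷ as)  bs (s≤s k<) = afterVisit-++ˡ as bs k<

afterVisit-++ʳ : ∀ {k} as bs → afterVisit (#visits as ℕ.+ k) (as ++ bs) ≡ afterVisit k bs
afterVisit-++ʳ []           bs = refl
afterVisit-++ʳ (false ∷ as) bs = afterVisit-++ʳ as bs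
afterVisit-++ʳ (true ∷ as)  bs = afterVisit-++ʳ as bs

before≡length-beforeVisit : ∀ k bs → before (suc k) bs ≡ length (beforeVisit k bs)
before≡length-beforeVisit k       []           = refl
before≡length-beforeVisit k       (false ∷ bs) = cong suc (before≡length-beforeVisit k bs)
before≡length-beforeVisit zero    (true ∷ bs)  = refl
before≡length-beforeVisit (suc k) (true ∷ bs)  = cong suc (before≡length-beforeVisit k bs)

before-afterVisit : ∀ {a} d bs → a ℕ.< #visits bs →
  before (suc a ℕ.+ suc d) bs ≡ suc (before (suc a) bs ℕ.+ before (suc d) (afterVisit a bs))
before-afterVisit         d (false ∷ bs) a<       = cong suc (before-afterVisit d bs a<)
before-afterVisit {zero}  d (true ∷ bs)  _        = refl
before-afterVisit {suc a} d (true ∷ bs)  (s≤s a<) = cong suc (before-afterVisit d bs a<)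

between≡length-beforeVisit-afterVisit : ∀ a d bs → a ℕ.< #visits bs →
  between (suc a) (suc a ℕ.+ suc d) bs ≡ length (beforeVisit d (afterVisit a bs))
between≡length-beforeVisit-afterVisit a d bs a< = begin
  before (suc a ℕ.+ suc d) bs ∸ x ∸ 1       ≡⟨ cong (λ z → z ∸ x ∸ 1) (before-afterVisit d bs a<) ⟩
  suc (x ℕ.+ y) ∸ x ∸ 1                     ≡⟨ cong (λ z → z ∸ x ∸ 1) (ℕ.+-suc x y) ⟨
  x ℕ.+ suc y ∸ x ∸ 1                       ≡⟨ cong (_∸ 1) (ℕ.m+n∸m≡n x (suc y)) ⟩
  y                                         ≡⟨ before≡length-beforeVisit d (afterVisit a bs) ⟩
  length (beforeVisit d (afterVisit a bs))  ∎
  where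
  open ≡-Reasoning
  x = before (suc a) bs
  y = before (suc d) (afterVisit a bs)

data VisitIn (as bs : List Bool) : ℕ → Set where
  inˡ : ∀ {k} → k ℕ.< #visits as → VisitIn as bs k
  inʳ : ∀ {k} → k ℕ.< #visits bs → VisitIn as bs (#visits as ℕ.+ k)

visitIn : ∀ as bs {k} → k ℕ.< #visits (as ++ bs) → VisitIn as bs k
visitIn []           bs         k<       = inʳ k<
visitIn (false ∷ as) bs         k<       with visitIn as bs k<
... | inˡ k<ˡ = inˡ k<ˡ
... | inʳ k<ʳ = inʳ k<ʳ
visitIn (true ∷ as)  bs {zero}  _        = inˡ (s≤s z≤n)
visitIn (true ∷ as)  bs {suc k} (s≤s k<) with visitIn as bs k<
... | inˡ k<ˡ = inˡ (s≤s k<ˡ)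
... | inʳ k<ʳ = inʳ k<ʳ

length-covering : ∀ {n} (xs : List (Fin n)) → (∀ x → x ∈ xs) → n ℕ.≤ length xs
length-covering xs complete = injective⇒≤ λ {x} {y} same-index →
  trans (lookup-index (complete x))
        (trans (cong (lookup xs) same-index) (sym (lookup-index (complete y))))

module _ {n : ℕ} where

  mutual
    maxPathCost : Iteration n → ℕ
    maxPathCost (node _ c) = maxPathCostS c

    maxPathCostS : List (Step n) → ℕ
    maxPathCostS s = ownT s ℕ.+ maxChildPathCost s

    maxChildPathCost : List (Step n) → ℕ
    maxChildPathCost []           = 0
    maxChildPathCost (ins ∷ s)    = maxChildPathCost s
    maxChildPathCost (vis _ ∷ s)  = maxChildPathCost s
    maxChildPathCost (call t ∷ s) = maxPathCost t ⊔ maxChildPathCost s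

  maxChildPathCost-noChildren : ∀ s → childrenS s ≡ [] → maxChildPathCost s ≡ 0
  maxChildPathCost-noChildren []          _  = refl
  maxChildPathCost-noChildren (ins ∷ s)   eq = maxChildPathCost-noChildren s eq
  maxChildPathCost-noChildren (vis _ ∷ s) eq = maxChildPathCost-noChildren s eq

  mutual
    maxPathCost∈pathCosts : ∀ t → maxPathCost t ∈ pathCosts t
    maxPathCost∈pathCosts (node _ c) with childrenS c in eq
    ... | []    = here (trans (cong (ownT c ℕ.+_) (maxChildPathCost-noChildren c eq))
                              (ℕ.+-identityʳ (ownT c)))
    ... | _ ∷ _ = ∈-map⁺ (ownT c ℕ.+_) (maxChildPathCost∈pathCostsS c eq)

    maxChildPathCost∈pathCostsS : ∀ s {t ts} → childrenS s ≡ t ∷ ts →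
                                  maxChildPathCost s ∈ pathCostsS s
    maxChildPathCost∈pathCostsS (ins ∷ s)    eq = maxChildPathCost∈pathCostsS s eq
    maxChildPathCost∈pathCostsS (vis _ ∷ s)  eq = maxChildPathCost∈pathCostsS s eq
    maxChildPathCost∈pathCostsS (call t ∷ s) _  with childrenS s in eq
    ... | [] rewrite maxChildPathCost-noChildren s eq | ℕ.⊔-identityʳ (maxPathCost t) =
      ∈-++⁺ˡ (maxPathCost∈pathCosts t)
    ... | _ ∷ _ with ℕ.⊔-sel (maxPathCost t) (maxChildPathCost s)
    ...   | inj₁ ⊔≡ᵗ rewrite ⊔≡ᵗ = ∈-++⁺ˡ (maxPathCost∈pathCosts t)
    ...   | inj₂ ⊔≡ˢ rewrite ⊔≡ˢ = ∈-++⁺ʳ (pathCosts t) (maxChildPathCost∈pathCostsS s eq)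

  maxPathCostS-call-≥ˡ+ownT : ∀ t s → maxPathCost t ℕ.+ ownT s ℕ.≤ maxPathCostS (call t ∷ s)
  maxPathCostS-call-≥ˡ+ownT t s =
    ℕ.≤-trans (ℕ.≤-reflexive (ℕ.+-comm (maxPathCost t) (ownT s)))
              (ℕ.+-monoʳ-≤ (ownT s) (ℕ.m≤m⊔n (maxPathCost t) (maxChildPathCost s)))

  maxPathCostS-call-≥ˡ : ∀ t s → maxPathCost t ℕ.≤ maxPathCostS (call t ∷ s)
  maxPathCostS-call-≥ˡ t s =
    ℕ.≤-trans (ℕ.m≤m+n (maxPathCost t) (ownT s)) (maxPathCostS-call-≥ˡ+ownT t s)

  maxPathCostS-call-≥ʳ : ∀ t s → maxPathCostS s ℕ.≤ maxPathCostS (call t ∷ s)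
  maxPathCostS-call-≥ʳ t s = ℕ.+-monoʳ-≤ (ownT s) (ℕ.m≤n⊔m (maxPathCost t) (maxChildPathCost s))

  ownTrace : List (Step n) → List Bool
  ownTrace []           = []
  ownTrace (ins ∷ s)    = false ∷ ownTrace s
  ownTrace (vis _ ∷ s)  = true ∷ ownTrace s
  ownTrace (call _ ∷ s) = ownTrace s

  length-ownTrace : ∀ s → length (ownTrace s) ≡ ownT s
  length-ownTrace []           = refl
  length-ownTrace (ins ∷ s)    = cong suc (length-ownTrace s)
  length-ownTrace (vis _ ∷ s)  = cong suc (length-ownTrace s)
  length-ownTrace (call _ ∷ s) = length-ownTrace s

  #visits-ownTrace : ∀ s → #visits (ownTrace s) ≡ length (ownVisits s)
  #visits-ownTrace []           = refl
  #visits-ownTrace (ins ∷ s)    = #visits-ownTrace s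
  #visits-ownTrace (vis _ ∷ s)  = cong suc (#visits-ownTrace s)
  #visits-ownTrace (call _ ∷ s) = #visits-ownTrace s

  mutual
    #visits-trace : ∀ (t : Iteration n) → #visits (trace t) ≡ length (visits t)
    #visits-trace (node _ c) = #visits-traceS c

    #visits-traceS : ∀ (s : List (Step n)) → #visits (traceS s) ≡ length (visitsS s)
    #visits-traceS []           = refl
    #visits-traceS (ins ∷ s)    = #visits-traceS s
    #visits-traceS (vis _ ∷ s)  = cong suc (#visits-traceS s)
    #visits-traceS (call t ∷ s) = begin
      #visits (trace t ++ traceS s)             ≡⟨ #visits-++ (trace t) (traceS s) ⟩
      #visits (trace t) ℕ.+ #visits (traceS s)  ≡⟨ cong₂ ℕ._+_ (#visits-trace t) (#visits-traceS s) ⟩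
      length (visits t) ℕ.+ length (visitsS s)  ≡⟨ length-++ (visits t) ⟨
      length (visits t ++ visitsS s)            ∎
      where open ≡-Reasoning

module Excess (K : ℚ) where

  excess : List Bool → ℚ
  excess []           = 0ℚ
  excess (false ∷ bs) = 1ℚ + excess bs
  excess (true ∷ bs)  = (1ℚ - K) + excess bs

  excess-++ : ∀ as bs → excess (as ++ bs) ≡ excess as + excess bs
  excess-++ []           bs = sym (+-identityˡ (excess bs))
  excess-++ (false ∷ as) bs =
    trans (cong (_+_ 1ℚ) (excess-++ as bs)) (sym (+-assoc 1ℚ (excess as) (excess bs)))
  excess-++ (true ∷ as)  bs =
    trans (cong (_+_ (1ℚ - K)) (excess-++ as bs)) (sym (+-assoc (1ℚ - K) (excess as) (excess bs)))

  ι-length-excess : ∀ bs → ι (length bs) ≡ excess bs + K * ι (#visits bs)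
  ι-length-excess []           = sym (trans (+-identityˡ (K * 0ℚ)) (*-zeroʳ K))
  ι-length-excess (false ∷ bs) = begin
    ι (suc (length bs))                     ≡⟨ ι-suc (length bs) ⟩
    1ℚ + ι (length bs)                      ≡⟨ cong (_+_ 1ℚ) (ι-length-excess bs) ⟩
    1ℚ + (excess bs + K * ι (#visits bs))   ≡⟨ +-assoc 1ℚ (excess bs) _ ⟨
    1ℚ + excess bs + K * ι (#visits bs)     ∎
    where open ≡-Reasoning
  ι-length-excess (true ∷ bs)  = begin
    ι (suc (length bs))                             ≡⟨ ι-suc (length bs) ⟩
    1ℚ + ι (length bs)                              ≡⟨ cong (_+_ 1ℚ) (ι-length-excess bs) ⟩
    1ℚ + (excess bs + K * v)                        ≡⟨ regroup (excess bs) v ⟩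
    1ℚ - K + excess bs + K * (1ℚ + v)               ≡⟨ cong (λ w → 1ℚ - K + excess bs + K * w)
                                                            (ι-suc (#visits bs)) ⟨
    1ℚ - K + excess bs + K * ι (suc (#visits bs))   ∎
    where
    open ≡-Reasoning
    open +-*-Solver
    v = ι (#visits bs)
    regroup : ∀ e v → 1ℚ + (e + K * v) ≡ 1ℚ - K + e + K * (1ℚ + v)
    regroup = solve 3 (λ k e v → con 1ℚ :+ (e :+ k :* v) := con 1ℚ :- k :+ e :+ k :* (con 1ℚ :+ v))
                      refl K

  ι-ownT-excess : ∀ {n} (s : List (Step n)) →
                  ι (ownT s) ≡ excess (ownTrace s) + K * ι (length (ownVisits s))
  ι-ownT-excess s = begin
    ι (ownT s)                                          ≡⟨ cong ι (length-ownTrace s) ⟨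
    ι (length (ownTrace s))                             ≡⟨ ι-length-excess (ownTrace s) ⟩
    excess (ownTrace s) + K * ι (#visits (ownTrace s))  ≡⟨ cong (λ v → excess (ownTrace s) + K * ι v)
                                                                (#visits-ownTrace s) ⟩
    excess (ownTrace s) + K * ι (length (ownVisits s))  ∎
    where open ≡-Reasoning

  Amortised : ∀ {n} → Iteration n → Set
  Amortised t = excess (trace t) ≤ 0ℚ

module Pyramid {n : ℕ} (T⋆ μ : ℚ) (0<T⋆ : 0ℚ < T⋆) where
  open Excess (μ * T⋆)

  Pyramid : Iteration n → Set
  Pyramid = PyramidAt T⋆ 0<T⋆ μ

  childPotential : List (Step n) → ℚ
  childPotential s = sumℚ (map potential (childrenS s))

  private
    instance
      T⋆≢0 : ℚ.NonZero T⋆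
      T⋆≢0 = pos⇒nonZero T⋆ {{ℚ.positive 0<T⋆}}
      T⋆≥0 : ℚ.NonNegative T⋆
      T⋆≥0 = ℚ.nonNegative (<⇒≤ 0<T⋆)

    ÷T⋆*T⋆ : ∀ p → (p ÷ T⋆) * T⋆ ≡ p
    ÷T⋆*T⋆ p =
      trans (*-assoc p (ℚ.1/ T⋆) T⋆) (trans (cong (_*_ p) (*-inverseˡ T⋆)) (*-identityʳ p))

  pyramid⇒excess-ownTrace : ∀ Φ c → Pyramid (node Φ c) →
                            excess (ownTrace c) + T⋆ * Φ ≤ T⋆ * childPotential c
  pyramid⇒excess-ownTrace Φ c pyramid = +-cancelʳ-≤ (μ * T⋆ * V) (begin
    excess (ownTrace c) + T⋆ * Φ + μ * T⋆ * V  ≡⟨ xy∙z≈xz∙y (excess (ownTrace c)) (T⋆ * Φ) _ ⟩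
    excess (ownTrace c) + μ * T⋆ * V + T⋆ * Φ  ≡⟨ cong (_+ T⋆ * Φ) (ι-ownT-excess c) ⟨
    ι (ownT c) + T⋆ * Φ                        ≡⟨ cong (_+ T⋆ * Φ) (÷T⋆*T⋆ (ι (ownT c))) ⟨
    (ι (ownT c) ÷ T⋆) * T⋆ + T⋆ * Φ            ≤⟨ +-monoˡ-≤ (T⋆ * Φ) (*-monoʳ-≤-nonNeg T⋆ pyramid) ⟩
    (P + μ * V - Φ) * T⋆ + T⋆ * Φ              ≡⟨ expand P V ⟩
    T⋆ * P + μ * T⋆ * V                        ∎)
    where
    open ≤-Reasoning
    open +-*-Solver
    P = childPotential c
    V = ι (length (ownVisits c))
    expand : ∀ P V → (P + μ * V - Φ) * T⋆ + T⋆ * Φ ≡ T⋆ * P + μ * T⋆ * V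
    expand = solve 5 (λ m t f p v → (p :+ m :* v :- f) :* t :+ t :* f := t :* p :+ m :* t :* v)
                     refl μ T⋆ Φ

  mutual
    excess-trace≤ : ∀ Φ c → All Pyramid (nodes (node Φ c)) → excess (traceS c) + T⋆ * Φ ≤ 0ℚ
    excess-trace≤ Φ c (pyramid ∷ pyramids) = +-cancelʳ-≤ (T⋆ * P) (begin
      excess (traceS c) + T⋆ * Φ + T⋆ * P  ≡⟨ xy∙z≈xz∙y (excess (traceS c)) (T⋆ * Φ) (T⋆ * P) ⟩
      excess (traceS c) + T⋆ * P + T⋆ * Φ  ≤⟨ +-monoˡ-≤ (T⋆ * Φ) (excess-traceS≤ c pyramids) ⟩
      excess (ownTrace c) + T⋆ * Φ         ≤⟨ pyramid⇒excess-ownTrace Φ c pyramid ⟩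
      T⋆ * P                               ≡⟨ +-identityˡ (T⋆ * P) ⟨
      0ℚ + T⋆ * P                          ∎)
      where
      open ≤-Reasoning
      P = childPotential c

    excess-traceS≤ : ∀ s → All Pyramid (nodesS s) →
                     excess (traceS s) + T⋆ * childPotential s ≤ excess (ownTrace s)
    excess-traceS≤ []          _ = ≤-reflexive (trans (+-identityˡ (T⋆ * 0ℚ)) (*-zeroʳ T⋆))
    excess-traceS≤ (ins ∷ s)   h =
      ≤-trans (≤-reflexive (+-assoc 1ℚ (excess (traceS s)) _)) (+-monoʳ-≤ 1ℚ (excess-traceS≤ s h))
    excess-traceS≤ (vis _ ∷ s) h =
      ≤-trans (≤-reflexive (+-assoc (1ℚ - μ * T⋆) (excess (traceS s)) _))
              (+-monoʳ-≤ (1ℚ - μ * T⋆) (excess-traceS≤ s h))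
    excess-traceS≤ (call t@(node Φ c) ∷ s) h = begin
      excess (traceS c ++ traceS s) + T⋆ * (Φ + P)
        ≡⟨ cong₂ _+_ (excess-++ (traceS c) (traceS s)) (*-distribˡ-+ T⋆ Φ P) ⟩
      (excess (traceS c) + excess (traceS s)) + (T⋆ * Φ + T⋆ * P)
        ≡⟨ interchange (excess (traceS c)) (excess (traceS s)) (T⋆ * Φ) (T⋆ * P) ⟩
      (excess (traceS c) + T⋆ * Φ) + (excess (traceS s) + T⋆ * P)
        ≤⟨ p≤0∧q≤r⇒p+q≤r (excess-trace≤ Φ c (++⁻ˡ (nodes t) h)) (excess-traceS≤ s (++⁻ʳ (nodes t) h)) ⟩
      excess (ownTrace s)
        ∎
      where
      open ≤-Reasoning
      P = childPotential s

  mutual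
    amortised : ∀ t → All Pyramid (nodes t) → All (λ Y → 0ℚ < potential Y) (nodes t) →
                All Amortised (nodes t)
    amortised (node Φ c) pyramids (0<Φ ∷ positives) =
      ≤-trans (p≤p+q (excess (traceS c)) 0≤T⋆Φ) (excess-trace≤ Φ c pyramids)
        ∷ amortisedS c (All.tail pyramids) positives
      where
      0≤T⋆Φ : 0ℚ ≤ T⋆ * Φ
      0≤T⋆Φ = <⇒≤ (positive⁻¹ (T⋆ * Φ) {{pos*pos⇒pos T⋆ {{ℚ.positive 0<T⋆}} Φ {{ℚ.positive 0<Φ}}}})

    amortisedS : ∀ s → All Pyramid (nodesS s) → All (λ Y → 0ℚ < potential Y) (nodesS s) →
                 All Amortised (nodesS s)
    amortisedS []           _ _ = []
    amortisedS (ins ∷ s)    = amortisedS s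
    amortisedS (vis _ ∷ s)  = amortisedS s
    amortisedS (call t ∷ s) pyramids positives =
      ++⁺ (amortised t (++⁻ˡ (nodes t) pyramids) (++⁻ˡ (nodes t) positives))
          (amortisedS s (++⁻ʳ (nodes t) pyramids) (++⁻ʳ (nodes t) positives))

module Windows {n : ℕ} (K : ℚ) (0≤K : 0ℚ ≤ K) where
  open Excess K

  private
    step≤ι-suc : ∀ {x e} h → x ≤ 1ℚ → e ≤ ι h → x + e ≤ ι (suc h)
    step≤ι-suc h x≤1 e≤h = ≤-trans (+-mono-≤ x≤1 e≤h) (≤-reflexive (sym (ι-suc h)))

    1+step≤ι-suc : ∀ {x} e h → x ≤ 1ℚ → 1ℚ + e ≤ ι h → 1ℚ + (x + e) ≤ ι (suc h)
    1+step≤ι-suc {x} e h x≤1 1+e≤h =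
      ≤-trans (≤-reflexive (x∙yz≈y∙xz 1ℚ x e)) (step≤ι-suc h x≤1 1+e≤h)

    1-K≤1 : 1ℚ - K ≤ 1ℚ
    1-K≤1 = p-q≤p 1ℚ 0≤K

    ι-mono-suc : ∀ h → ι h ≤ ι (suc h)
    ι-mono-suc h = ι-mono-≤ (ℕ.n≤1+n h)

    ι-mono-double : ∀ {h h′} → h ℕ.≤ h′ → ι (h ℕ.+ h) ≤ ι (h′ ℕ.+ h′)
    ι-mono-double h≤h′ = ι-mono-≤ (ℕ.+-mono-≤ h≤h′ h≤h′)

  excess≤ownT : ∀ (s : List (Step n)) → All Amortised (nodesS s) → excess (traceS s) ≤ ι (ownT s)
  excess≤ownT []                      _ = ≤-refl
  excess≤ownT (ins ∷ s)               h = step≤ι-suc (ownT s) ≤-refl (excess≤ownT s h)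
  excess≤ownT (vis _ ∷ s)             h = step≤ι-suc (ownT s) 1-K≤1 (excess≤ownT s h)
  excess≤ownT (call t@(node _ _) ∷ s) h = begin
    excess (trace t ++ traceS s)          ≡⟨ excess-++ (trace t) (traceS s) ⟩
    excess (trace t) + excess (traceS s)  ≤⟨ p≤0∧q≤r⇒p+q≤r (All.head (++⁻ˡ (nodes t) h))
                                                           (excess≤ownT s (++⁻ʳ (nodes t) h)) ⟩
    ι (ownT s)                            ∎
    where open ≤-Reasoning

  prefix-excess : ∀ (s : List (Step n)) {k} → All Amortised (nodesS s) →
                  k ℕ.< #visits (traceS s) →
                  1ℚ + excess (beforeVisit k (traceS s)) ≤ ι (maxPathCostS s)
  prefix-excess (ins ∷ s) {k}       h k<       =
    1+step≤ι-suc (excess (beforeVisit k (traceS s))) (maxPathCostS s) ≤-refl (prefix-excess s h k<)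
  prefix-excess (vis _ ∷ s) {zero}  h _        = ι-mono-≤ {1} {suc (maxPathCostS s)} (s≤s z≤n)
  prefix-excess (vis _ ∷ s) {suc k} h (s≤s k<) =
    1+step≤ι-suc (excess (beforeVisit k (traceS s))) (maxPathCostS s) 1-K≤1 (prefix-excess s h k<)
  prefix-excess (call t@(node _ c) ∷ s) h k< with visitIn (traceS c) (traceS s) k<
  ... | inˡ k<ᶜ rewrite beforeVisit-++ˡ (traceS c) (traceS s) k<ᶜ =
    ≤-trans (prefix-excess c (All.tail (++⁻ˡ (nodes t) h)) k<ᶜ) (ι-mono-≤ (maxPathCostS-call-≥ˡ t s))
  ... | inʳ {k} k<ˢ rewrite beforeVisit-++ʳ {k} (traceS c) (traceS s)
                          | excess-++ (traceS c) (beforeVisit k (traceS s)) = begin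
    1ℚ + (excess (traceS c) + excess headˢ)  ≡⟨ x∙yz≈y∙xz 1ℚ (excess (traceS c)) (excess headˢ) ⟩
    excess (traceS c) + (1ℚ + excess headˢ)  ≤⟨ p≤0∧q≤r⇒p+q≤r (All.head (++⁻ˡ (nodes t) h))
                                                  (prefix-excess s (++⁻ʳ (nodes t) h) k<ˢ) ⟩
    ι (maxPathCostS s)                       ≤⟨ ι-mono-≤ (maxPathCostS-call-≥ʳ t s) ⟩
    ι (maxPathCostS (call t ∷ s))            ∎
    where
    open ≤-Reasoning
    headˢ = beforeVisit k (traceS s)

  suffix-excess : ∀ (s : List (Step n)) {k} → All Amortised (nodesS s) →
                  k ℕ.< #visits (traceS s) →
                  1ℚ + excess (afterVisit k (traceS s)) ≤ ι (maxPathCostS s)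
  suffix-excess (ins ∷ s)           h k<       =
    ≤-trans (suffix-excess s h k<) (ι-mono-suc (maxPathCostS s))
  suffix-excess (vis _ ∷ s) {zero}  h _        = begin
    1ℚ + excess (traceS s)    ≤⟨ +-monoʳ-≤ 1ℚ (excess≤ownT s h) ⟩
    1ℚ + ι (ownT s)           ≡⟨ ι-suc (ownT s) ⟨
    ι (suc (ownT s))          ≤⟨ ι-mono-≤ (s≤s (ℕ.m≤m+n (ownT s) (maxChildPathCost s))) ⟩
    ι (suc (maxPathCostS s))  ∎
    where open ≤-Reasoning
  suffix-excess (vis _ ∷ s) {suc k} h (s≤s k<) =
    ≤-trans (suffix-excess s h k<) (ι-mono-suc (maxPathCostS s))
  suffix-excess (call t@(node _ c) ∷ s) h k< with visitIn (traceS c) (traceS s) k<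
  ... | inˡ {k} k<ᶜ rewrite afterVisit-++ˡ (traceS c) (traceS s) k<ᶜ
                          | excess-++ (afterVisit k (traceS c)) (traceS s) = begin
    1ℚ + (excess tailᶜ + excess (traceS s))  ≡⟨ +-assoc 1ℚ (excess tailᶜ) (excess (traceS s)) ⟨
    1ℚ + excess tailᶜ + excess (traceS s)    ≤⟨ +-mono-≤ (suffix-excess c (All.tail (++⁻ˡ (nodes t) h)) k<ᶜ)
                                                         (excess≤ownT s (++⁻ʳ (nodes t) h)) ⟩
    ι (maxPathCost t) + ι (ownT s)           ≡⟨ ι-+ (maxPathCost t) (ownT s) ⟨
    ι (maxPathCost t ℕ.+ ownT s)             ≤⟨ ι-mono-≤ (maxPathCostS-call-≥ˡ+ownT t s) ⟩
    ι (maxPathCostS (call t ∷ s))            ∎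
    where
    open ≤-Reasoning
    tailᶜ = afterVisit k (traceS c)
  ... | inʳ {k} k<ˢ rewrite afterVisit-++ʳ {k} (traceS c) (traceS s) =
    ≤-trans (suffix-excess s (++⁻ʳ (nodes t) h) k<ˢ) (ι-mono-≤ (maxPathCostS-call-≥ʳ t s))

  gap-excess : ∀ (s : List (Step n)) {a d} → All Amortised (nodesS s) →
               a ℕ.< #visits (traceS s) → d ℕ.< #visits (afterVisit a (traceS s)) →
               1ℚ + 1ℚ + excess (beforeVisit d (afterVisit a (traceS s)))
                 ≤ ι (maxPathCostS s ℕ.+ maxPathCostS s)
  gap-excess (ins ∷ s)                h a<       d< =
    ≤-trans (gap-excess s h a< d<) (ι-mono-double (ℕ.n≤1+n (maxPathCostS s)))
  gap-excess (vis _ ∷ s) {zero} {d}   h _        d< = begin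
    1ℚ + 1ℚ + excess (beforeVisit d (traceS s))    ≡⟨ +-assoc 1ℚ 1ℚ (excess (beforeVisit d (traceS s))) ⟩
    1ℚ + (1ℚ + excess (beforeVisit d (traceS s)))  ≤⟨ +-monoʳ-≤ 1ℚ (prefix-excess s h d<) ⟩
    1ℚ + ι h′                                      ≡⟨ ι-suc h′ ⟨
    ι (suc h′)                                     ≤⟨ ι-mono-≤ (ℕ.m≤m+n (suc h′) (suc h′)) ⟩
    ι (suc h′ ℕ.+ suc h′)                          ∎
    where
    open ≤-Reasoning
    h′ = maxPathCostS s
  gap-excess (vis _ ∷ s) {suc a}      h (s≤s a<) d< =
    ≤-trans (gap-excess s h a< d<) (ι-mono-double (ℕ.n≤1+n (maxPathCostS s)))
  gap-excess (call t@(node _ c) ∷ s) h a< d< with visitIn (traceS c) (traceS s) a<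
  ... | inʳ {a} a<ˢ rewrite afterVisit-++ʳ {a} (traceS c) (traceS s) =
    ≤-trans (gap-excess s (++⁻ʳ (nodes t) h) a<ˢ d<) (ι-mono-double (maxPathCostS-call-≥ʳ t s))
  ... | inˡ {a} a<ᶜ rewrite afterVisit-++ˡ (traceS c) (traceS s) a<ᶜ
    with visitIn (afterVisit a (traceS c)) (traceS s) d<
  ...   | inˡ d<ᶜ rewrite beforeVisit-++ˡ (afterVisit a (traceS c)) (traceS s) d<ᶜ =
    ≤-trans (gap-excess c (All.tail (++⁻ˡ (nodes t) h)) a<ᶜ d<ᶜ)
            (ι-mono-double (maxPathCostS-call-≥ˡ t s))
  ...   | inʳ {d} d<ˢ rewrite beforeVisit-++ʳ {d} (afterVisit a (traceS c)) (traceS s)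
                            | excess-++ (afterVisit a (traceS c)) (beforeVisit d (traceS s)) = begin
    1ℚ + 1ℚ + (excess tailᶜ + excess headˢ)    ≡⟨ interchange 1ℚ 1ℚ (excess tailᶜ) (excess headˢ) ⟩
    (1ℚ + excess tailᶜ) + (1ℚ + excess headˢ)  ≤⟨ +-mono-≤ (suffix-excess c (All.tail (++⁻ˡ (nodes t) h)) a<ᶜ)
                                                           (prefix-excess s (++⁻ʳ (nodes t) h) d<ˢ) ⟩
    ι (maxPathCost t) + ι (maxPathCostS s)     ≡⟨ ι-+ (maxPathCost t) (maxPathCostS s) ⟨
    ι (maxPathCost t ℕ.+ maxPathCostS s)       ≤⟨ ι-mono-≤ (ℕ.+-mono-≤ (maxPathCostS-call-≥ˡ t s)
                                                                       (maxPathCostS-call-≥ʳ t s)) ⟩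
    ι (h′ ℕ.+ h′)                              ∎
    where
    open ≤-Reasoning
    tailᶜ = afterVisit a (traceS c)
    headˢ = beforeVisit d (traceS s)
    h′ = maxPathCostS (call t ∷ s)

module Bounds {n : ℕ} (K : ℚ) (0≤K : 0ℚ ≤ K) (c : List (Step n))
              (amortised : All (Excess.Amortised K) (nodesS c))
              (Δ : ℚ) (maxPathCost≤Δ : ι (maxPathCostS c) ≤ Δ) where
  open Excess K
  open Windows {n} K 0≤K

  private
    instance
      K≥0 : ℚ.NonNegative K
      K≥0 = ℚ.nonNegative 0≤K

    tr : List Bool
    tr = traceS c

    ι-length≤ : ∀ {k} bs → #visits bs ℕ.≤ k → ι (length bs) ≤ excess bs + ι k * K
    ι-length≤ {k} bs ≤k = begin
      ι (length bs)                   ≡⟨ ι-length-excess bs ⟩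
      excess bs + K * ι (#visits bs)  ≤⟨ +-monoʳ-≤ (excess bs) (*-monoˡ-≤-nonNeg K (ι-mono-≤ ≤k)) ⟩
      excess bs + K * ι k             ≡⟨ cong (_+_ (excess bs)) (*-comm K (ι k)) ⟩
      excess bs + ι k * K             ∎
      where open ≤-Reasoning

    *K-mono-≤ : ∀ {m n} → m ℕ.≤ n → ι m * K ≤ ι n * K
    *K-mono-≤ m≤n = *-monoʳ-≤-nonNeg K (ι-mono-≤ m≤n)

  before-bound : ∀ j → 1 ℕ.≤ j → j ℕ.≤ #visits tr → ι (before j tr) ≤ Δ + ι j * K - 1ℚ
  before-bound (suc k) _ j≤ = 1+p≤q⇒p≤q-1 (begin
    1ℚ + ι (before (suc k) tr)  ≡⟨ cong (λ m → 1ℚ + ι m) (before≡length-beforeVisit k tr) ⟩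
    1ℚ + ι (length U)           ≤⟨ +-monoʳ-≤ 1ℚ (ι-length≤ U (#visits-beforeVisit k tr)) ⟩
    1ℚ + (excess U + ι k * K)   ≡⟨ +-assoc 1ℚ (excess U) (ι k * K) ⟨
    1ℚ + excess U + ι k * K     ≤⟨ +-mono-≤ (≤-trans (prefix-excess c {k} amortised j≤) maxPathCost≤Δ)
                                            (*K-mono-≤ (ℕ.n≤1+n k)) ⟩
    Δ + ι (suc k) * K           ∎)
    where
    open ≤-Reasoning
    U = beforeVisit k tr

  1≤Δ : 0 ℕ.< #visits tr → 1ℚ ≤ Δ
  1≤Δ 0<#visits = begin
    1ℚ                  ≤⟨ p≤p+q 1ℚ 0≤excess ⟩
    1ℚ + excess U       ≤⟨ prefix-excess c {0} amortised 0<#visits ⟩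
    ι (maxPathCostS c)  ≤⟨ maxPathCost≤Δ ⟩
    Δ                   ∎
    where
    open ≤-Reasoning
    U = beforeVisit 0 tr
    0≤excess : 0ℚ ≤ excess U
    0≤excess = begin
      0ℚ                 ≤⟨ 0≤ι (length U) ⟩
      ι (length U)       ≤⟨ ι-length≤ U (#visits-beforeVisit 0 tr) ⟩
      excess U + 0ℚ * K  ≡⟨ cong (_+_ (excess U)) (*-zeroˡ K) ⟩
      excess U + 0ℚ      ≡⟨ +-identityʳ (excess U) ⟩
      excess U           ∎

  between-self-bound : ∀ i → 1 ℕ.≤ i → i ℕ.≤ #visits tr →
                       ι (between i i tr) ≤ ι 2 * Δ + ι (i ∸ i) * K - 1ℚ
  between-self-bound i 1≤i i≤ rewrite ℕ.n∸n≡0 (before i tr) | ℕ.n∸n≡0 i = 1+p≤q⇒p≤q-1 (begin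
    1ℚ + 0ℚ           ≡⟨ +-identityʳ 1ℚ ⟩
    1ℚ                ≤⟨ 1≤Δ′ ⟩
    Δ                 ≤⟨ p≤p+q Δ (≤-trans (0≤ι 1) 1≤Δ′) ⟩
    Δ + Δ             ≡⟨ 2*p≡p+p Δ ⟨
    ι 2 * Δ           ≡⟨ +-identityʳ (ι 2 * Δ) ⟨
    ι 2 * Δ + 0ℚ      ≡⟨ cong (_+_ (ι 2 * Δ)) (*-zeroˡ K) ⟨
    ι 2 * Δ + 0ℚ * K  ∎)
    where
    open ≤-Reasoning
    1≤Δ′ = 1≤Δ (ℕ.≤-trans 1≤i i≤)

  between-gap-bound : ∀ a d → suc a ℕ.+ suc d ℕ.≤ #visits tr →
                      ι (between (suc a) (suc a ℕ.+ suc d) tr) ≤ ι 2 * Δ + ι (suc d) * K - 1ℚ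
  between-gap-bound a d j≤ = 1+p≤q⇒p≤q-1 (begin
    1ℚ + ι (between (suc a) (suc a ℕ.+ suc d) tr)
      ≡⟨ cong (λ m → 1ℚ + ι m) (between≡length-beforeVisit-afterVisit a d tr a<) ⟩
    1ℚ + ι (length W)
      ≤⟨ +-monoˡ-≤ (ι (length W)) (p≤p+q 1ℚ (0≤ι 1)) ⟩
    1ℚ + 1ℚ + ι (length W)
      ≤⟨ +-monoʳ-≤ (1ℚ + 1ℚ) (ι-length≤ W (#visits-beforeVisit d (afterVisit a tr))) ⟩
    1ℚ + 1ℚ + (excess W + ι d * K)
      ≡⟨ +-assoc (1ℚ + 1ℚ) (excess W) (ι d * K) ⟨
    1ℚ + 1ℚ + excess W + ι d * K
      ≤⟨ +-mono-≤ gap≤ (*K-mono-≤ (ℕ.n≤1+n d)) ⟩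
    ι 2 * Δ + ι (suc d) * K
      ∎)
    where
    open ≤-Reasoning
    W = beforeVisit d (afterVisit a tr)
    a< : a ℕ.< #visits tr
    a< = ℕ.≤-trans (s≤s (ℕ.m≤m+n a (suc d))) j≤
    d< : d ℕ.< #visits (afterVisit a tr)
    d< = ℕ.+-cancelˡ-≤ (suc a) (suc d) _ (ℕ.≤-trans j≤ (ℕ.≤-reflexive (#visits-afterVisit tr a<)))
    gap≤ : 1ℚ + 1ℚ + excess W ≤ ι 2 * Δ
    gap≤ = begin
      1ℚ + 1ℚ + excess W                       ≤⟨ gap-excess c amortised a< d< ⟩
      ι (maxPathCostS c ℕ.+ maxPathCostS c)    ≡⟨ ι-+ (maxPathCostS c) (maxPathCostS c) ⟩
      ι (maxPathCostS c) + ι (maxPathCostS c)  ≤⟨ +-mono-≤ maxPathCost≤Δ maxPathCost≤Δ ⟩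
      Δ + Δ                                    ≡⟨ 2*p≡p+p Δ ⟨
      ι 2 * Δ                                  ∎

  between-bound : ∀ i j → 1 ℕ.≤ i → i ℕ.≤ j → j ℕ.≤ #visits tr →
                  ι (between i j tr) ≤ ι 2 * Δ + ι (j ∸ i) * K - 1ℚ
  between-bound (suc a) j 1≤i i≤j j≤ with ℕ.m≤n⇒∃[o]m+o≡n i≤j
  ... | zero  , refl rewrite ℕ.+-identityʳ a = between-self-bound (suc a) 1≤i j≤
  ... | suc d , refl rewrite ℕ.m+n∸m≡n (suc a) (suc d) = between-gap-bound a d j≤

lemma2p5 : ∀ (n : ℕ) (root : Iteration n) (T⋆ μ Δ : ℚ) (0<T⋆ : 0ℚ < T⋆) →
    Enumerates root →
    0ℚ < μ →
    (∀ Y → Y ∈ nodes root → 0ℚ < potential Y) →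
    (∀ Y → Y ∈ nodes root → PyramidAt T⋆ 0<T⋆ μ Y) →
    (∀ c → c ∈ pathCosts root → ι c ≤ Δ) →
    (∀ (i j : ℕ) → 1 Data.Nat.≤ i → i Data.Nat.≤ j → j Data.Nat.≤ n →
       ι (between i j (trace root)) ≤ ι 2 * Δ + ι (j ∸ i) * μ * T⋆ - 1ℚ)
    × (∀ (j : ℕ) → 1 Data.Nat.≤ j → j Data.Nat.≤ n →
       ι (before j (trace root)) ≤ Δ + ι j * μ * T⋆ - 1ℚ)
lemma2p5 n root@(node _ c) T⋆ μ Δ 0<T⋆ (_ , complete , _) 0<μ positive pyramid paths =
  (λ i j 1≤i i≤j j≤n →
     ≤-trans (between-bound i j 1≤i i≤j (ℕ.≤-trans j≤n n≤#visits))
             (≤-reflexive (cong (λ x → ι 2 * Δ + x - 1ℚ) (sym (*-assoc (ι (j ∸ i)) μ T⋆))))) ,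
  (λ j 1≤j j≤n →
     ≤-trans (before-bound j 1≤j (ℕ.≤-trans j≤n n≤#visits))
             (≤-reflexive (cong (λ x → Δ + x - 1ℚ) (sym (*-assoc (ι j) μ T⋆)))))
  where
  0≤μT⋆ : 0ℚ ≤ μ * T⋆
  0≤μT⋆ = <⇒≤ (positive⁻¹ (μ * T⋆) {{pos*pos⇒pos μ {{ℚ.positive 0<μ}} T⋆ {{ℚ.positive 0<T⋆}}}})
  amortised : All (Excess.Amortised (μ * T⋆)) (nodesS c)
  amortised = Pyramid.amortisedS T⋆ μ 0<T⋆ c (All.tail (All.tabulate (pyramid _)))
                                             (All.tail (All.tabulate (positive _)))
  n≤#visits : n ℕ.≤ #visits (traceS c)
  n≤#visits =
    subst (n ℕ.≤_) (sym (#visits-trace root)) (length-covering (visits root) complete)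
  open Bounds (μ * T⋆) 0≤μT⋆ c amortised Δ (paths _ (maxPathCost∈pathCosts root))
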